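{- Let $m\ge 4$, $t,g$ be positive integers and $\alpha=(t-1)-g$. Consider a bin configuration with bins indexed $1,\dots,m$ and loads $L_1,\dots,L_m$ such that $L_1+\dots+L_{m-1}\ge (m-1)g-\alpha$. Then there exists an online algorithm which, from this configuration, packs all remaining items into the $m$ bins so that every bin has load at most $t-1$.
   Context: A bin configuration consists of the current loads $L_1,\dots,L_m$ (nonnegative integers) of $m$ bins together with the multiset $\mathcal{I}$ of positive integer items presented so far, such that $\mathcal{I}$ can be partitioned into $m$ parts with sums exactly $L_1,\dots,L_m$. "Packs all remaining items into the $m$ bins so that every bin has load at most $t-1$" means: for every subsequent online sequence of positive integer items $e_1,e_2,\dots$ such that at every step $\mathcal{I}\cup\{e_1,\dots,e_k\}$ can be partitioned into $m$ parts each of total size at most $g$, the algorithm irrevocably assigns each arriving item to one of the $m$ bins (which start with loads $L_1,\dots,L_m$) and no bin load ever exceeds $t-1$. -}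

module Defs where

open import Data.Nat using (ℕ; zero; suc; _+_; _≤_)
open import Data.Fin using (Fin; inject₁; _≟_) renaming (zero to fzero; suc to fsuc)
open import Data.List using (List; []; _∷_; _++_; [_])
open import Data.Product using (∃)
open import Relation.Binary.PropositionalEquality using (_≡_)
open import Data.Bool using (if_then_else_)
open import Relation.Nullary.Decidable using (⌊_⌋)
import Data.Vec as Vec

open Data.List using (length) public

loadsOf : ∀ {m} (xs : List ℕ) → (Fin (length xs) → Fin m) → Fin m → ℕ
loadsOf []       σ j = 0
loadsOf (x ∷ xs) σ j =
  (if ⌊ σ fzero ≟ j ⌋ then x else 0) + loadsOf xs (λ i → σ (fsuc i)) j

PartitionsInto : (m : ℕ) → List ℕ → (Fin m → ℕ) → Set
PartitionsInto m xs L = ∃ λ (σ : Fin (length xs) → Fin m) → ∀ j → loadsOf xs σ j ≡ L j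

Feasible : (m g : ℕ) → List ℕ → Set
Feasible m g xs = ∃ λ (σ : Fin (length xs) → Fin m) → ∀ j → loadsOf xs σ j ≤ g

sumAllButLast : ∀ {m} → (Fin m → ℕ) → ℕ
sumAllButLast {zero}  L = 0
sumAllButLast {suc n} L = Vec.sum (Vec.tabulate (λ i → L (inject₁ i)))

-- A deterministic online algorithm: given the items that arrived so far
-- (in order) and the current item, it chooses a bin for the current item.
OnlineAlg : ℕ → Set
OnlineAlg m = List ℕ → ℕ → Fin m

addTo : ∀ {m} → (Fin m → ℕ) → Fin m → ℕ → (Fin m → ℕ)
addTo L b e j = if ⌊ b ≟ j ⌋ then L j + e else L j

runFrom : ∀ {m} → OnlineAlg m → (Fin m → ℕ) → List ℕ → List ℕ → (Fin m → ℕ)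
runFrom A L hist []       = L
runFrom A L hist (e ∷ es) = runFrom A (addTo L (A hist e) e) (hist ++ [ e ]) es

run : ∀ {m} → OnlineAlg m → (Fin m → ℕ) → List ℕ → (Fin m → ℕ)
run A L es = runFrom A L [] es

module Submission where

-- The algorithm that puts every arriving item into the last bin m already
-- works.  Write S for the total load of bins 1,…,m-1, T = t - 1, and P for
-- the volume of the items placed so far.  Bins 1,…,m-1 never change, so they
-- stay at most T.  For the last bin we use volume conservation: once the next
-- item has arrived, everything presented is still feasible, so the total
-- volume satisfies S + L_m + P ≤ m·g.  The hypothesis
-- S ≥ (m-1)g - (T - g) rearranges to (m-1)g + g ≤ S + T, and combining both
-- gives L_m + P ≤ T.

open import Defs
open import Data.Nat using (ℕ; suc; _≤_; _<_; _*_; _∸_)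
open import Data.Integer using (ℤ; +_; _-_) renaming (_≤_ to _≤ℤ_)
open import Data.Fin using (Fin)
open import Data.List using (List; _++_; take)
open import Data.List.Relation.Unary.All using (All)
open import Data.Product using (∃)

open import Data.Nat using (zero; z≤n; _+_)
open import Data.Nat.Properties
  using (≤-refl; ≤-trans; +-mono-≤; +-monoʳ-≤; +-cancelˡ-≤;
         +-identityʳ; +-assoc; +-comm; +-0-commutativeMonoid; module ≤-Reasoning)
open import Data.Nat.ListAction using (sum)
open import Data.Nat.ListAction.Properties using (sum-++)
import Data.Integer as ℤ
import Data.Integer.Properties as ℤ
import Data.Integer.Solver as ℤ-Solver
open import Data.Fin using (inject₁; fromℕ; _≟_) renaming (zero to fzero; suc to fsuc)
open import Data.List using ([]; _∷_; [_])
open import Data.Product using (_,_)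
open import Data.Bool using (true; false; if_then_else_)
open import Relation.Nullary using (yes; no)
open import Relation.Nullary.Decidable using (⌊_⌋)
open import Relation.Binary.PropositionalEquality
  using (_≡_; refl; sym; trans; cong; cong₂; subst; subst₂; module ≡-Reasoning)
open import Function using (_∘_)
import Data.Vec as Vec
open import Algebra.Properties.CommutativeMonoid.Sum +-0-commutativeMonoid
  using (∑-distrib-+; sum-cong-≗; sum-init-last; sum-replicate-zero)
  renaming (sum to ∑)

sumAllButLast≡∑init : ∀ {n} (L : Fin (suc n) → ℕ) → sumAllButLast L ≡ ∑ (L ∘ inject₁)
sumAllButLast≡∑init L = vec-sum-tabulate (L ∘ inject₁)
  where
  vec-sum-tabulate : ∀ {n} (f : Fin n → ℕ) → Vec.sum (Vec.tabulate f) ≡ ∑ f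
  vec-sum-tabulate {zero}  f = refl
  vec-sum-tabulate {suc n} f = cong (_+_ (f fzero)) (vec-sum-tabulate (f ∘ fsuc))

∑-indicator : ∀ {m} (b : Fin m) x → ∑ (λ j → if ⌊ b ≟ j ⌋ then x else 0) ≡ x
∑-indicator {suc m} fzero x =
  trans (cong (_+_ x) (sum-replicate-zero m)) (+-identityʳ x)
∑-indicator {suc m} (fsuc b) x = trans (sum-cong-≗ shift) (∑-indicator b x)
  where
  shift : ∀ i → (if ⌊ fsuc b ≟ fsuc i ⌋ then x else 0) ≡ (if ⌊ b ≟ i ⌋ then x else 0)
  shift i with b ≟ i
  ... | yes refl = refl
  ... | no _     = refl

∑-bounded : ∀ {m} (f : Fin m → ℕ) g → (∀ j → f j ≤ g) → ∑ f ≤ m * g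
∑-bounded {zero}  f g f≤g = z≤n
∑-bounded {suc m} f g f≤g = +-mono-≤ (f≤g fzero) (∑-bounded (f ∘ fsuc) g (f≤g ∘ fsuc))

∑-loadsOf : ∀ {m} xs (σ : Fin (length xs) → Fin m) → ∑ (loadsOf xs σ) ≡ sum xs
∑-loadsOf {m} []       σ = sum-replicate-zero m
∑-loadsOf     (x ∷ xs) σ = begin
  ∑ (loadsOf (x ∷ xs) σ)
    ≡⟨ ∑-distrib-+ (λ j → if ⌊ σ fzero ≟ j ⌋ then x else 0) (loadsOf xs (σ ∘ fsuc)) ⟩
  ∑ (λ j → if ⌊ σ fzero ≟ j ⌋ then x else 0) + ∑ (loadsOf xs (σ ∘ fsuc))
    ≡⟨ cong₂ _+_ (∑-indicator (σ fzero) x) (∑-loadsOf xs (σ ∘ fsuc)) ⟩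
  x + sum xs ∎
  where open ≡-Reasoning

partition-volume : ∀ {m} xs {L : Fin m → ℕ} → PartitionsInto m xs L → sum xs ≡ ∑ L
partition-volume xs (σ , σ≡L) = trans (sym (∑-loadsOf xs σ)) (sum-cong-≗ σ≡L)

feasible-volume : ∀ {m g} xs → Feasible m g xs → sum xs ≤ m * g
feasible-volume {m} {g} xs (σ , σ≤g) =
  subst (_≤ m * g) (∑-loadsOf xs σ) (∑-bounded (loadsOf xs σ) g σ≤g)

sum-take-mono : ∀ k xs → sum (take k xs) ≤ sum (take (suc k) xs)
sum-take-mono zero    []       = ≤-refl
sum-take-mono zero    (x ∷ xs) = z≤n
sum-take-mono (suc k) []       = ≤-refl
sum-take-mono (suc k) (x ∷ xs) = +-monoʳ-≤ x (sum-take-mono k xs)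

always : ∀ {m} → Fin m → OnlineAlg m
always b _ _ = b

run-always : ∀ {m} (b : Fin m) L hist es j →
  runFrom (always b) L hist es j ≡ addTo L b (sum es) j
run-always b L hist [] j with ⌊ b ≟ j ⌋
... | true  = sym (+-identityʳ (L j))
... | false = refl
run-always b L hist (e ∷ es) j =
  trans (run-always b (addTo L b e) (hist ++ [ e ]) es j) add-twice
  where
  add-twice : addTo (addTo L b e) b (sum es) j ≡ addTo L b (e + sum es) j
  add-twice with ⌊ b ≟ j ⌋
  ... | true  = +-assoc (L j) e (sum es)
  ... | false = refl

addTo-bound : ∀ {m} (L : Fin m → ℕ) b s j c →
  L j ≤ c → (b ≡ j → L j + s ≤ c) → addTo L b s j ≤ c
addTo-bound L b s j c Lj≤c b≡j⇒ with b ≟ j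
... | yes b≡j = b≡j⇒ b≡j
... | no  _   = Lj≤c

-- The integer hypothesis a - (T - g) ≤ d, stated without truncated
-- subtraction: a + g ≤ d + T.
slack-bound : ∀ a T g d → (+ a) - ((+ T) - (+ g)) ≤ℤ + d → a + g ≤ d + T
slack-bound a T g d h =
  ℤ.drop‿+≤+ (subst₂ _≤ℤ_ rearrange (sym (ℤ.pos-+ d T)) (ℤ.+-monoˡ-≤ (+ T) h))
  where
  open ℤ-Solver.+-*-Solver
  rearrange : (+ a) - ((+ T) - (+ g)) ℤ.+ (+ T) ≡ + (a + g)
  rearrange = trans (solve 3 (λ a T g → a :- (T :- g) :+ T := a :+ g) refl (+ a) (+ T) (+ g))
                    (sym (ℤ.pos-+ a g))

last-bin-bound : ∀ n g S ℓ T → S + ℓ ≤ n * g + g → n * g + g ≤ S + T → ℓ ≤ T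
last-bin-bound n g S ℓ T total slack = +-cancelˡ-≤ S ℓ T (≤-trans total slack)

mainTheorem3 : (m t g : ℕ) → 4 ≤ m → 1 ≤ t → 1 ≤ g →
    (L : Fin m → ℕ) (I : List ℕ) →
    All (λ x → 1 ≤ x) I →
    PartitionsInto m I L →
    (∀ j → L j ≤ t ∸ 1) →
    (+ ((m ∸ 1) * g)) - ((+ (t ∸ 1)) - (+ g)) ≤ℤ + sumAllButLast L →
    ∃ λ (A : OnlineAlg m) →
    (es : List ℕ) → All (λ x → 1 ≤ x) es →
    (∀ k → Feasible m g (I ++ take (suc k) es)) →
    ∀ k j → run A L (take k es) j ≤ t ∸ 1
mainTheorem3 (suc n) t g _ _ _ L I _ partition L≤T slack-hyp = always (fromℕ n) , bound
  where
  T = t ∸ 1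
  S = ∑ (L ∘ inject₁)
  slack : n * g + g ≤ S + T
  slack = slack-bound (n * g) T g S (subst (λ s → _ ≤ℤ + s) (sumAllButLast≡∑init L) slack-hyp)
  volume-I : sum I ≡ S + L (fromℕ n)
  volume-I = trans (partition-volume I partition) (sum-init-last L)
  bound : (es : List ℕ) → All (λ x → 1 ≤ x) es → (∀ k → Feasible (suc n) g (I ++ take (suc k) es)) →
          ∀ k j → run (always (fromℕ n)) L (take k es) j ≤ T
  bound es _ feasible k j rewrite run-always (fromℕ n) L [] (take k es) j =
    addTo-bound L (fromℕ n) (sum (take k es)) j T (L≤T j) last-bin
    where
    open ≤-Reasoning
    total : S + (L (fromℕ n) + sum (take k es)) ≤ n * g + g
    total = begin
      S + (L (fromℕ n) + sum (take k es))      ≤⟨ +-monoʳ-≤ S (+-monoʳ-≤ _ (sum-take-mono k es)) ⟩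
      S + (L (fromℕ n) + sum (take (suc k) es)) ≡⟨ sym (+-assoc S _ _) ⟩
      S + L (fromℕ n) + sum (take (suc k) es)   ≡⟨ cong (_+ _) volume-I ⟨
      sum I + sum (take (suc k) es)             ≡⟨ sum-++ I (take (suc k) es) ⟨
      sum (I ++ take (suc k) es)                ≤⟨ feasible-volume (I ++ take (suc k) es) (feasible k) ⟩
      suc n * g                                 ≡⟨ +-comm g (n * g) ⟩
      n * g + g                                 ∎
    last-bin : fromℕ n ≡ j → L j + sum (take k es) ≤ T
    last-bin refl = last-bin-bound n g S _ T total slack
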